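{- Let $\mathbb{K}$ be a field, $n \in \mathbb{N}$, $\lambda \in \mathbb{N}_0^n$, let $G$ be a $\lambda$-lacunary subset of $\mathbb{K}[x_1,\ldots,x_n]$, and let $\le_a$ be an admissible ordering of $\mathbb{N}_0^n$. Let $f \in \mathbb{K}[x_1,\ldots,x_n]$ and let \[ f = \sum_{j=1}^t c_j\, x^{\delta_j} g_j + r \] be a natural standard expression of $f$ by $G$ with respect to $\le_a$. Then every $(G,\lambda)$-stable monomial of $f$ belongs to $\operatorname{Mon}(r)$.
   Context: $\operatorname{Mon}(f)$: monomials appearing in $f$ with nonzero coefficient; $\operatorname{Supp}(f)$: their exponents. $\alpha \sqsubseteq \beta$ means $\alpha_i \le \beta_i$ for all $i$. An admissible ordering is a total order $\le_a$ on $\mathbb{N}_0^n$ with $\alpha \sqsubseteq \beta \Rightarrow \alpha \le_a \beta$ and $\alpha \le_a \beta \Rightarrow \alpha+\gamma \le_a \beta+\gamma$; $\mathrm{Lm}(p)$ is the monomial of $p \ne 0$ with $\le_a$-maximal exponent. $g$ is $\lambda$-lacunary if it contains a monomial $x^\mu$ such that for every $x^\nu \in \operatorname{Mon}(g)$ and every $i$, $\nu_i < \mu_i - \lambda_i$ or $\nu_i = \mu_i$ (then $\mathrm{Lm}(g) = x^\mu$ for every admissible ordering); $G$ is $\lambda$-lacunary if all its elements are. $x^\gamma$ is $(G,\lambda,\alpha)$-shading if: (i) $\alpha \sqsubseteq \gamma$, $\alpha \ne \gamma$; (ii) for every $i$ with $\alpha_i < \gamma_i$ there is $g \in G$ with $\mathrm{Lm}(g)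 \mid x^\gamma$ and $\deg_{x_i}(g) > 0$; (iii) for every $i$ with $\alpha_i < \gamma_i$, $\alpha_i + \lambda_i < \gamma_i$. $x^\alpha$ is $(G,\lambda)$-stable in $f$ if $\alpha \in \operatorname{Supp}(f)$, no $g \in G$ has $\mathrm{Lm}(g) \mid x^\alpha$, and no element of $\operatorname{Mon}(f)$ is $(G,\lambda,\alpha)$-shading. For $G \subseteq \mathbb{K}[x_1,\ldots,x_n]\setminus\{0\}$, a natural standard expression of $f$ by $G$ with remainder $r$ with respect to $\le_a$ is an equality $f = \sum_{j=1}^t c_j x^{\delta_j} g_j + r$ with $t \in \mathbb{N}_0$, $c_j \in \mathbb{K}\setminus\{0\}$, $\delta_j \in \mathbb{N}_0^n$, $g_j \in G$, $r \in \mathbb{K}[x_1,\ldots,x_n]$, such that for each $j$: $\mathrm{Lm}(c_j x^{\delta_j} g_j) \in \operatorname{Mon}(f - \sum_{i=1}^{j-1} c_i x^{\delta_i} g_i)$ and $\mathrm{Lm}(c_j x^{\delta_j} g_j) \notin \operatorname{Mon}(f - \sum_{i=1}^{j} c_i x^{\delta_i} g_i)$, and no monomial of $r$ is divisible by $\mathrm{Lm}(g)$ for any $g \in G$. -}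

module Defs where

open import Level using (Level; _⊔_; suc)
open import Algebra.Bundles using (CommutativeRing)
open import Data.Nat as ℕ using (ℕ; _<_; _≤_)
open import Data.Nat.Properties using (_≟_)
open import Data.Fin using (Fin)
open import Data.Vec using (Vec; lookup; zipWith)
open import Data.Vec.Properties using (≡-dec)
open import Data.List using (List; []; _∷_; map; foldr; _++_)
open import Data.Product using (Σ; ∃; _×_; _,_)
open import Data.Sum using (_⊎_)
open import Relation.Nullary using (¬_; yes; no)
open import Relation.Binary.PropositionalEquality using (_≡_)
open import Relation.Binary.Structures using (IsTotalOrder)

record Field (c ℓ : Level) : Set (Level.suc (c ⊔ ℓ)) where
  field
    commRing : CommutativeRing c ℓ
  open CommutativeRing commRing public
  field
    1≉0      : ¬ (1# ≈ 0#)
    inverse  : ∀ x → ¬ (x ≈ 0#) → Σ Carrier (λ y → (x * y) ≈ 1#)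

Exp : ℕ → Set
Exp n = Vec ℕ n

_⊑_ : ∀ {n} → Exp n → Exp n → Set
α ⊑ β = ∀ i → lookup α i ≤ lookup β i

_⊕_ : ∀ {n} → Exp n → Exp n → Exp n
_⊕_ = zipWith ℕ._+_

record Admissible (n : ℕ) : Set₁ where
  field
    _≤a_       : Exp n → Exp n → Set
    isTotal    : IsTotalOrder _≡_ _≤a_
    ⊑⇒≤a       : ∀ {α β} → α ⊑ β → α ≤a β
    translate  : ∀ {α β} γ → α ≤a β → (α ⊕ γ) ≤a (β ⊕ γ)

module Poly {c ℓ : Level} (K : Field c ℓ) (n : ℕ) where
  open Field K

  -- A polynomial in K[x₁,…,xₙ] is represented by a finite list of terms
  -- (coefficient, exponent); its coefficient at α is the sum of the
  -- coefficients of all terms with exponent α.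
  Pol : Set c
  Pol = List (Carrier × Exp n)

  coeff : Pol → Exp n → Carrier
  coeff p α = foldr step 0# p
    where
    step : Carrier × Exp n → Carrier → Carrier
    step (a , β) acc with ≡-dec _≟_ α β
    ... | yes _ = a + acc
    ... | no  _ = acc

  _∈Supp_ : Exp n → Pol → Set ℓ
  α ∈Supp p = ¬ (coeff p α ≈ 0#)

  scale : Carrier → Exp n → Pol → Pol
  scale a δ g = map (λ { (b , β) → (a * b , δ ⊕ β) }) g

  _-ₚ_ : Pol → Pol → Pol
  p -ₚ q = p ++ map (λ { (b , β) → (- b , β) }) q

  _≈ₚ_ : Pol → Pol → Set ℓ
  p ≈ₚ q = ∀ α → coeff p α ≈ coeff q α

  Lacunary : Exp n → Pol → Set ℓ
  Lacunary λv g = ∃ λ μ → μ ∈Supp g ×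
    (∀ ν → ν ∈Supp g → ∀ i →
       (lookup ν i ℕ.+ lookup λv i < lookup μ i) ⊎ (lookup ν i ≡ lookup μ i))

  module _ (A : Admissible n) where
    open Admissible A

    IsLm : Pol → Exp n → Set ℓ
    IsLm p μ = μ ∈Supp p × (∀ ν → ν ∈Supp p → ν ≤a μ)

    LmDivides : Pol → Exp n → Set ℓ
    LmDivides g γ = ∃ λ μ → IsLm g μ × μ ⊑ γ

    PosDeg : Pol → Fin n → Set ℓ
    PosDeg g i = ∃ λ ν → ν ∈Supp g × 0 < lookup ν i

    module _ {ℓG : Level} (G : Pol → Set ℓG) (λv : Exp n) where

      Shading : Exp n → Exp n → Set (c ⊔ ℓ ⊔ ℓG)
      Shading α γ =
          α ⊑ γ
        × ¬ (α ≡ γ)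
        × (∀ i → lookup α i < lookup γ i →
             ∃ λ g → G g × LmDivides g γ × PosDeg g i)
        × (∀ i → lookup α i < lookup γ i →
             lookup α i ℕ.+ lookup λv i < lookup γ i)

      Stable : Pol → Exp n → Set (c ⊔ ℓ ⊔ ℓG)
      Stable f α =
          α ∈Supp f
        × (∀ g → G g → ¬ LmDivides g α)
        × (∀ γ → γ ∈Supp f → ¬ Shading α γ)

    module _ {ℓG : Level} (G : Pol → Set ℓG) where

      -- The sequence of steps (c_j, δ_j, g_j) of the standard expression,
      -- starting from the current polynomial f - Σ_{i<j} c_i x^{δ_i} g_i.
      data NatSteps : Pol → List (Carrier × Exp n × Pol) → Pol → Set (c ⊔ ℓ ⊔ ℓG) where
        done : ∀ {f r} → f ≈ₚ r → NatSteps f [] r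
        step : ∀ {f a δ g s r} →
          ¬ (a ≈ 0#) →
          G g →
          (∃ λ μ → IsLm (scale a δ g) μ
                 × μ ∈Supp f
                 × ¬ (μ ∈Supp (f -ₚ scale a δ g))) →
          NatSteps (f -ₚ scale a δ g) s r →
          NatSteps f ((a , δ , g) ∷ s) r

      NaturalStdExpr : Pol → List (Carrier × Exp n × Pol) → Pol → Set (c ⊔ ℓ ⊔ ℓG)
      NaturalStdExpr f s r =
          NatSteps f s r
        × (∀ β → β ∈Supp r → ∀ g → G g → ¬ LmDivides g β)

{-# OPTIONS --safe #-}
-- Stability of x^α is an invariant of each step f ↦ f − c x^δ g. By lacunarity, the top
-- exponent μ of g is ⊑-maximal in g, so Lm(c x^δ g) = x^(δ+μ), which occurs in the current
-- polynomial. If some monomial x^(δ+ν) of c x^δ g were x^α itself or shaded α, then x^(δ+μ)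
-- would shade α: where α_i < δ_i + ν_i the old witnesses still serve, and where
-- α_i = δ_i + ν_i < δ_i + μ_i, g itself is a witness and the lacunary gap of g gives the
-- margin λ_i. Hence a step neither cancels x^α nor creates a shading monomial, and the
-- polynomial left at the end is r.
module Submission where

open import Defs
open import Level using (Level; _⊔_)
open import Data.Nat as Nat using (ℕ; _≤_; _<_; _∸_; z≤n)
import Data.Nat.Properties as ℕₚ
open import Data.List using (List; []; _∷_; _++_)
open import Data.Product using (_×_; _,_; ∃)
open import Data.Sum using (_⊎_; inj₁; inj₂; [_,_])
open import Data.Vec using ([]; _∷_; lookup; zipWith)
open import Data.Vec.Properties using (≡-dec; lookup-zipWith; zipWith-comm)
open import Relation.Nullary using (¬_; yes; no; contradiction)
import Relation.Binary.PropositionalEquality as ≡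
open ≡ using (_≡_)
open import Relation.Binary.Structures using (IsTotalOrder)

private variable
  n : ℕ

module _ where
  open Nat using (_+_)
  open ℕₚ using (+-comm; +-monoʳ-≤; m≤n+m; m+n∸m≡n)

  lookup-⊕ : ∀ (α β : Exp n) i → lookup (α ⊕ β) i ≡ lookup α i + lookup β i
  lookup-⊕ α β i = lookup-zipWith _+_ i α β

  ⊕-comm : ∀ (α β : Exp n) → α ⊕ β ≡ β ⊕ α
  ⊕-comm = zipWith-comm +-comm

  _⊖_ : Exp n → Exp n → Exp n
  _⊖_ = zipWith _∸_

  α⊕β⊖α≡β : ∀ (α β : Exp n) → (α ⊕ β) ⊖ α ≡ β
  α⊕β⊖α≡β []      []      = ≡.refl
  α⊕β⊖α≡β (a ∷ α) (b ∷ β) = ≡.cong₂ _∷_ (m+n∸m≡n a b) (α⊕β⊖α≡β α β)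

  ⊕-cancelˡ : ∀ (δ : Exp n) {β β′} → δ ⊕ β ≡ δ ⊕ β′ → β ≡ β′
  ⊕-cancelˡ δ {β} {β′} eq = begin
    β              ≡⟨ α⊕β⊖α≡β δ β ⟨
    (δ ⊕ β) ⊖ δ    ≡⟨ ≡.cong (_⊖ δ) eq ⟩
    (δ ⊕ β′) ⊖ δ   ≡⟨ α⊕β⊖α≡β δ β′ ⟩
    β′             ∎
    where open ≡.≡-Reasoning

  ⊕-monoʳ-⊑ : ∀ (δ : Exp n) {β β′} → β ⊑ β′ → (δ ⊕ β) ⊑ (δ ⊕ β′)
  ⊕-monoʳ-⊑ δ {β} {β′} β⊑β′ i = ≡.subst₂ _≤_ (≡.sym (lookup-⊕ δ β i)) (≡.sym (lookup-⊕ δ β′ i))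
    (+-monoʳ-≤ (lookup δ i) (β⊑β′ i))

  β⊑δ⊕β : ∀ (δ β : Exp n) → β ⊑ (δ ⊕ β)
  β⊑δ⊕β δ β i = ≡.subst (lookup β i ≤_) (≡.sym (lookup-⊕ δ β i)) (m≤n+m _ _)

module Coefficients {c ℓ : Level} (K : Field c ℓ) (n : ℕ) where
  open Field K
  open Poly K n
  open import Algebra.Properties.Ring ring using (-0#≈0#; -‿+-comm; x∙y⁻¹≈ε⇒x≈y; x≈y⇒x∙y⁻¹≈ε)
  open import Relation.Binary.Reasoning.Setoid setoid

  *-nonzero : ∀ {x y} → ¬ x ≈ 0# → ¬ y ≈ 0# → ¬ x * y ≈ 0#
  *-nonzero {x} {y} x≉0 y≉0 xy≈0 with inverse x x≉0
  ... | x⁻¹ , xx⁻¹≈1 = y≉0 (begin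
    y              ≈⟨ *-identityˡ y ⟨
    1# * y         ≈⟨ *-congʳ (trans (sym xx⁻¹≈1) (*-comm x x⁻¹)) ⟩
    x⁻¹ * x * y    ≈⟨ *-assoc x⁻¹ x y ⟩
    x⁻¹ * (x * y)  ≈⟨ *-congˡ xy≈0 ⟩
    x⁻¹ * 0#       ≈⟨ zeroʳ x⁻¹ ⟩
    0#             ∎)

  coeff-++ : ∀ p q α → coeff (p ++ q) α ≈ coeff p α + coeff q α
  coeff-++ []            q α = sym (+-identityˡ (coeff q α))
  coeff-++ ((a , β) ∷ p) q α with ≡-dec ℕₚ._≟_ α β
  ... | yes _ = trans (+-congˡ (coeff-++ p q α)) (sym (+-assoc a _ _))
  ... | no  _ = coeff-++ p q α

  coeff-negate : ∀ q α → coeff ([] -ₚ q) α ≈ - coeff q α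
  coeff-negate []            α = sym -0#≈0#
  coeff-negate ((b , β) ∷ q) α with ≡-dec ℕₚ._≟_ α β
  ... | yes _ = trans (+-congˡ (coeff-negate q α)) (-‿+-comm b _)
  ... | no  _ = coeff-negate q α

  coeff-sub : ∀ p q α → coeff (p -ₚ q) α ≈ coeff p α - coeff q α
  coeff-sub p q α = trans (coeff-++ p ([] -ₚ q) α) (+-congˡ (coeff-negate q α))

  ∈Supp-sub : ∀ p q α → α ∈Supp p → ¬ α ∈Supp q → α ∈Supp (p -ₚ q)
  ∈Supp-sub p q α α∈p α∉q p-q≈0 =
    α∉q λ q≈0 → α∈p (trans (x∙y⁻¹≈ε⇒x≈y _ _ (trans (sym (coeff-sub p q α)) p-q≈0)) q≈0)

  -- ≈ need not be decidable, so only the double negation is available.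
  ∈Supp-sub⁻ : ∀ p q α → α ∈Supp (p -ₚ q) → ¬ ¬ (α ∈Supp p ⊎ α ∈Supp q)
  ∈Supp-sub⁻ p q α α∈p-q α∉p⊎q =
    α∉p⊎q (inj₁ λ p≈0 → α∉p⊎q (inj₂ λ q≈0 →
      α∈p-q (trans (coeff-sub p q α) (x≈y⇒x∙y⁻¹≈ε (trans p≈0 (sym q≈0))))))

  coeff-scale : ∀ a δ g β → coeff (scale a δ g) (δ ⊕ β) ≈ a * coeff g β
  coeff-scale a δ []             β = sym (zeroʳ a)
  coeff-scale a δ ((b , β′) ∷ g) β with ≡-dec ℕₚ._≟_ (δ ⊕ β) (δ ⊕ β′) | ≡-dec ℕₚ._≟_ β β′
  ... | yes _  | yes _  = trans (+-congˡ (coeff-scale a δ g β)) (sym (distribˡ a b _))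
  ... | yes eq | no  ne = contradiction (⊕-cancelˡ δ eq) ne
  ... | no  ne | yes eq = contradiction (≡.cong (δ ⊕_) eq) ne
  ... | no  _  | no  _  = coeff-scale a δ g β

  coeff-scale-outside : ∀ a δ g γ → (∀ β → ¬ γ ≡ δ ⊕ β) → coeff (scale a δ g) γ ≈ 0#
  coeff-scale-outside a δ []             γ γ∉δ⊕ = refl
  coeff-scale-outside a δ ((b , β) ∷ g) γ γ∉δ⊕ with ≡-dec ℕₚ._≟_ γ (δ ⊕ β)
  ... | yes eq = contradiction eq (γ∉δ⊕ β)
  ... | no  _  = coeff-scale-outside a δ g γ γ∉δ⊕

  ∈Supp-scale⁻ : ∀ a δ g γ → γ ∈Supp scale a δ g → ∃ λ β → γ ≡ δ ⊕ β × β ∈Supp g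
  ∈Supp-scale⁻ a δ g γ γ∈ with ≡-dec ℕₚ._≟_ (δ ⊕ (γ ⊖ δ)) γ
  ... | yes eq = γ ⊖ δ , ≡.sym eq , λ g≈0 →
    γ∈ (≡.subst (λ γ′ → coeff (scale a δ g) γ′ ≈ 0#) eq
          (trans (coeff-scale a δ g (γ ⊖ δ)) (trans (*-congˡ g≈0) (zeroʳ a))))
  ... | no  ne = contradiction (coeff-scale-outside a δ g γ γ∉δ⊕) γ∈
    where
    γ∉δ⊕ : ∀ β → ¬ γ ≡ δ ⊕ β
    γ∉δ⊕ β ≡.refl = ne (≡.cong (δ ⊕_) (α⊕β⊖α≡β δ β))

  ∈Supp-scale⁺ : ∀ a δ g β → ¬ a ≈ 0# → β ∈Supp g → (δ ⊕ β) ∈Supp scale a δ g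
  ∈Supp-scale⁺ a δ g β a≉0 β∈ δ⊕β≈0 =
    *-nonzero a≉0 β∈ (trans (sym (coeff-scale a δ g β)) δ⊕β≈0)

module _ {c ℓ : Level} (K : Field c ℓ) (n : ℕ) (A : Admissible n) where
  open Field K using (_≈_; 0#; trans)
  open Poly K n
  open Coefficients K n
  open ≡ using (refl)
  open Admissible A
  open Nat using (_+_)
  open ℕₚ using (≤-trans; ≤-reflexive; ≤-<-trans; <-≤-trans; <⇒≤; <⇒≢; m≤m+n;
                 +-assoc; +-monoʳ-<; +-cancelˡ-<; m≤n⇒m<n∨m≡n)

  IsLm-unique : ∀ p {μ μ′} → IsLm A p μ → IsLm A p μ′ → μ ≡ μ′
  IsLm-unique p (μ∈ , μ-max) (μ′∈ , μ′-max) =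
    IsTotalOrder.antisym isTotal (μ′-max _ μ∈) (μ-max _ μ′∈)

  IsLm-scale : ∀ a δ g μ → ¬ a ≈ 0# → IsLm A g μ → IsLm A (scale a δ g) (δ ⊕ μ)
  IsLm-scale a δ g μ a≉0 (μ∈ , μ-max) = ∈Supp-scale⁺ a δ g μ a≉0 μ∈ , below-δ⊕μ
    where
    below-δ⊕μ : ∀ γ → γ ∈Supp scale a δ g → γ ≤a (δ ⊕ μ)
    below-δ⊕μ γ γ∈ with ∈Supp-scale⁻ a δ g γ γ∈
    ... | β , refl , β∈ = ≡.subst₂ _≤a_ (⊕-comm β δ) (⊕-comm μ δ) (translate δ (μ-max β β∈))

  -- Lacunary λv g unfolds to ∃ λ μ → μ ∈Supp g × GapsBelow λv μ g.
  GapsBelow : Exp n → Exp n → Pol → Set ℓ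
  GapsBelow λv μ g = ∀ ν → ν ∈Supp g → ∀ i →
    (lookup ν i + lookup λv i < lookup μ i) ⊎ (lookup ν i ≡ lookup μ i)

  gaps⇒⊑ : ∀ {λv μ g} → GapsBelow λv μ g → ∀ ν → ν ∈Supp g → ν ⊑ μ
  gaps⇒⊑ gaps ν ν∈ i with gaps ν ν∈ i
  ... | inj₁ ν+λ<μ = ≤-trans (m≤m+n _ _) (<⇒≤ ν+λ<μ)
  ... | inj₂ ν≡μ   = ≤-reflexive ν≡μ

  gaps⇒IsLm : ∀ {λv μ g} → μ ∈Supp g → GapsBelow λv μ g → IsLm A g μ
  gaps⇒IsLm {λv} {μ} {g} μ∈ gaps = μ∈ , λ ν ν∈ → ⊑⇒≤a (gaps⇒⊑ {λv} {μ} {g} gaps ν ν∈)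

  module _ {ℓG : Level} (G : Pol → Set ℓG) (λv : Exp n) where

    -- Shading without α ≢ γ, so that it also covers γ = α.
    WeakShading : Exp n → Exp n → Set (c ⊔ ℓ ⊔ ℓG)
    WeakShading α γ =
        α ⊑ γ
      × (∀ i → lookup α i < lookup γ i → ∃ λ g → G g × LmDivides A g γ × PosDeg A g i)
      × (∀ i → lookup α i < lookup γ i → lookup α i + lookup λv i < lookup γ i)

    WeakShading-refl : ∀ α → WeakShading α α
    WeakShading-refl α =
        (λ i → ℕₚ.≤-refl)
      , (λ i α<α → contradiction refl (<⇒≢ α<α))
      , (λ i α<α → contradiction refl (<⇒≢ α<α))

    Shading⇒WeakShading : ∀ {α γ} → Shading A G λv α γ → WeakShading α γ
    Shading⇒WeakShading (α⊑γ , _ , covered , spread) = α⊑γ , covered , spread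

    shading-lift : ∀ {g μ α δ ν} → G g → μ ∈Supp g → GapsBelow λv μ g → ¬ LmDivides A g α →
      ν ∈Supp g → WeakShading α (δ ⊕ ν) → Shading A G λv α (δ ⊕ μ)
    shading-lift {g} {μ} {α} {δ} {ν} g∈G μ∈ gaps Lm∤α ν∈ (α⊑δ⊕ν , covered , spread) =
      (λ i → ≤-trans (α⊑δ⊕ν i) (δ⊕ν⊑δ⊕μ i)) , α≢δ⊕μ , covered′ , spread′
      where
      open ℕₚ.≤-Reasoning

      Lm-g : IsLm A g μ
      Lm-g = gaps⇒IsLm {λv} {μ} {g} μ∈ gaps

      δ⊕ν⊑δ⊕μ : (δ ⊕ ν) ⊑ (δ ⊕ μ)
      δ⊕ν⊑δ⊕μ = ⊕-monoʳ-⊑ δ (gaps⇒⊑ {λv} {μ} {g} gaps ν ν∈)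

      α≢δ⊕μ : ¬ α ≡ δ ⊕ μ
      α≢δ⊕μ refl = Lm∤α (μ , Lm-g , β⊑δ⊕β δ μ)

      tight⇒ν<μ : ∀ i → lookup α i ≡ lookup (δ ⊕ ν) i → lookup α i < lookup (δ ⊕ μ) i →
                  lookup ν i < lookup μ i
      tight⇒ν<μ i α≡ α< = +-cancelˡ-< (lookup δ i) _ _
        (≡.subst₂ _<_ (≡.trans α≡ (lookup-⊕ δ ν i)) (lookup-⊕ δ μ i) α<)

      covered′ : ∀ i → lookup α i < lookup (δ ⊕ μ) i →
                 ∃ λ h → G h × LmDivides A h (δ ⊕ μ) × PosDeg A h i
      covered′ i α< with m≤n⇒m<n∨m≡n (α⊑δ⊕ν i)
      ... | inj₁ α<′ with covered i α<′
      ...   | h , h∈G , (μh , Lm-h , μh⊑) , deg =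
        h , h∈G , (μh , Lm-h , λ j → ≤-trans (μh⊑ j) (δ⊕ν⊑δ⊕μ j)) , deg
      covered′ i α< | inj₂ α≡ =
        g , g∈G , (μ , Lm-g , β⊑δ⊕β δ μ) , (μ , μ∈ , ≤-<-trans z≤n (tight⇒ν<μ i α≡ α<))

      spread′ : ∀ i → lookup α i < lookup (δ ⊕ μ) i → lookup α i + lookup λv i < lookup (δ ⊕ μ) i
      spread′ i α< with m≤n⇒m<n∨m≡n (α⊑δ⊕ν i)
      ... | inj₁ α<′ = <-≤-trans (spread i α<′) (δ⊕ν⊑δ⊕μ i)
      ... | inj₂ α≡ with gaps ν ν∈ i
      ...   | inj₂ ν≡μ   = contradiction ν≡μ (<⇒≢ (tight⇒ν<μ i α≡ α<))
      ...   | inj₁ ν+λ<μ = begin-strict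
        lookup α i + lookup λv i                 ≡⟨ ≡.cong (_+ lookup λv i) α≡δ+ν ⟩
        lookup δ i + lookup ν i + lookup λv i    ≡⟨ +-assoc (lookup δ i) _ _ ⟩
        lookup δ i + (lookup ν i + lookup λv i)  <⟨ +-monoʳ-< (lookup δ i) ν+λ<μ ⟩
        lookup δ i + lookup μ i                  ≡⟨ lookup-⊕ δ μ i ⟨
        lookup (δ ⊕ μ) i                         ∎
        where
        α≡δ+ν : lookup α i ≡ lookup δ i + lookup ν i
        α≡δ+ν = ≡.trans α≡ (lookup-⊕ δ ν i)

    module _ (lacunary : ∀ g → G g → Lacunary λv g) where

      step-preserves-Stable : ∀ {p a δ g μ′ α} → ¬ a ≈ 0# → G g → IsLm A (scale a δ g) μ′ →
        μ′ ∈Supp p → Stable A G λv p α → Stable A G λv (p -ₚ scale a δ g) α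
      step-preserves-Stable {p} {a} {δ} {g} {μ′} {α} a≉0 g∈G Lm-q μ′∈p (α∈p , Lm∤α , unshaded) =
        ∈Supp-sub p q α α∈p (λ α∈q → unshaded-by-q α α∈q (WeakShading-refl α)) , Lm∤α , unshaded′
        where
        q : Pol
        q = scale a δ g

        unshaded-by-q : ∀ γ → γ ∈Supp q → ¬ WeakShading α γ
        unshaded-by-q γ γ∈q weak with lacunary g g∈G | ∈Supp-scale⁻ a δ g γ γ∈q
        ... | μ , μ∈ , gaps | ν , refl , ν∈ =
          unshaded μ′ μ′∈p (≡.subst (Shading A G λv α) (≡.sym μ′≡δ⊕μ)
            (shading-lift g∈G μ∈ gaps (Lm∤α g g∈G) ν∈ weak))
          where
          μ′≡δ⊕μ : μ′ ≡ δ ⊕ μ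
          μ′≡δ⊕μ = IsLm-unique q Lm-q (IsLm-scale a δ g μ a≉0 (gaps⇒IsLm {λv} {μ} {g} μ∈ gaps))

        unshaded′ : ∀ γ → γ ∈Supp (p -ₚ q) → ¬ Shading A G λv α γ
        unshaded′ γ γ∈ shading = ∈Supp-sub⁻ p q γ γ∈
          [ (λ γ∈p → unshaded γ γ∈p shading)
          , (λ γ∈q → unshaded-by-q γ γ∈q (Shading⇒WeakShading shading)) ]

      Stable⇒∈Supp-remainder : ∀ {p s r α} → NatSteps A G p s r → Stable A G λv p α → α ∈Supp r
      Stable⇒∈Supp-remainder {α = α} (done p≈r) (α∈p , _) r≈0 = α∈p (trans (p≈r α) r≈0)
      Stable⇒∈Supp-remainder {p} {α = α}
        (step {a = a} {δ} {g} a≉0 g∈G (μ′ , Lm-q , μ′∈p , _) steps) stable =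
        Stable⇒∈Supp-remainder steps
          (step-preserves-Stable {p} {a} {δ} {g} {μ′} {α} a≉0 g∈G Lm-q μ′∈p stable)

corollary4p5 : {c ℓ ℓG : Level} (K : Field c ℓ) (n : ℕ) → 1 ≤ n →
    (λv : Exp n) (G : Poly.Pol K n → Set ℓG) →
    (∀ g → G g → Poly.Lacunary K n λv g) →
    (A : Admissible n) (f : Poly.Pol K n)
    (s : List (Field.Carrier K × Exp n × Poly.Pol K n)) (r : Poly.Pol K n) →
    Poly.NaturalStdExpr K n A G f s r →
    ∀ α → Poly.Stable K n A G λv f α → Poly._∈Supp_ K n α r
corollary4p5 K n _ λv G lacunary A f s r (steps , _) α =
  Stable⇒∈Supp-remainder K n A G λv lacunary steps
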